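{- For every CNF $\varphi$, the one-sided treewidth of $\varphi$ is at most the incidence pathwidth of $\varphi$, and is at most the primal treewidth of $\varphi$ plus one.
   Context: A CNF is a set of clauses, each a set of literals. The incidence graph of $\varphi$ is the bipartite graph whose vertices are the variables and the clauses of $\varphi$, with a variable $x$ adjacent to a clause $C$ iff $x$ occurs (positively or negatively) in $C$. The primal graph has the variables as vertices, two being adjacent if they occur in a common clause; primal treewidth is the treewidth of the primal graph. Incidence pathwidth is the minimum width of a tree decomposition of the incidence graph whose underlying tree is a path. A tree decomposition $(T,\{B(t)\})$ of the incidence graph with $T$ rooted is one-sided if for each clause $C$, the set of nodes $t$ with $C\in B(t)$ induces a directed path of $T$ (a path going from an ancestor down to a descendant). The one-sided treewidth of $\varphi$ is the smallest width (maximum bag size minus one) of a one-sided tree decomposition of its incidence graph. -}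

module Defs where

open import Data.Nat using (ℕ; suc; _≤_)
open import Data.Fin using (Fin; zero; suc; inject₁; toℕ)
open import Data.Bool using (Bool)
open import Data.Product using (Σ; ∃; _×_; _,_)
open import Data.Sum using (_⊎_; inj₁; inj₂)
open import Data.List using (List; length)
open import Data.List.Membership.Propositional using (_∈_)
open import Relation.Binary.PropositionalEquality using (_≡_)
open import Level using (0ℓ) renaming (suc to lsuc)

-- A literal: polarity (true = positive) and a variable.
Literal : ℕ → Set
Literal n = Bool × Fin n

-- Each clause is a (finite) set of literals, given by a list.
-- Well-formedness: the clauses are pairwise distinct as sets of literals
-- (a CNF is a *set* of clauses), and every variable of Fin n occurs in
-- some clause (the variables of the CNF are exactly those occurring).
record CNF : Set where
  field
    nvars    : ℕ
    nclauses : ℕ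
    clause   : Fin nclauses → List (Literal nvars)
    distinct : ∀ i j → (∀ l → (l ∈ clause i → l ∈ clause j) × (l ∈ clause j → l ∈ clause i)) → i ≡ j
    occurs   : ∀ (x : Fin nvars) → ∃ λ i → ∃ λ b → (b , x) ∈ clause i

open CNF public

OccursIn : (φ : CNF) → Fin (nvars φ) → Fin (nclauses φ) → Set
OccursIn φ x C = ∃ λ b → (b , x) ∈ clause φ C

record Graph : Set₁ where
  field
    Vtx  : Set
    Edge : Vtx → Vtx → Set

open Graph public

incidenceGraph : CNF → Graph
incidenceGraph φ = record
  { Vtx  = Fin (nvars φ) ⊎ Fin (nclauses φ)
  ; Edge = E }
  where
  E : Fin (nvars φ) ⊎ Fin (nclauses φ) → Fin (nvars φ) ⊎ Fin (nclauses φ) → Set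
  E (inj₁ x) (inj₁ y) = Level.Lift 0ℓ (Data.Empty.⊥) where import Data.Empty
  E (inj₁ x) (inj₂ C) = OccursIn φ x C
  E (inj₂ C) (inj₁ x) = OccursIn φ x C
  E (inj₂ C) (inj₂ D) = Level.Lift 0ℓ (Data.Empty.⊥) where import Data.Empty

primalGraph : CNF → Graph
primalGraph φ = record
  { Vtx  = Fin (nvars φ)
  ; Edge = λ x y → (x ≡ y → Data.Empty.⊥) × ∃ λ C → OccursIn φ x C × OccursIn φ y C }
  where import Data.Empty

-- Rooted trees
-- A rooted tree with nodes Fin (suc t): node 0 is the root, and node (suc i)
-- has parent (parent i) whose index is ≤ i (i.e. smaller than suc i).
-- Every finite rooted tree admits such a numbering (e.g. BFS order).

record RootedTree : Set where
  field
    size-1   : ℕ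
    parent   : Fin size-1 → Fin (suc size-1)
    parent-< : ∀ i → toℕ (parent i) ≤ toℕ i

open RootedTree public

Node : RootedTree → Set
Node T = Fin (suc (size-1 T))

data TreeAdj (T : RootedTree) : Node T → Node T → Set where
  up   : ∀ i → TreeAdj T (suc i) (parent T i)
  down : ∀ i → TreeAdj T (parent T i) (suc i)

data WalkIn (T : RootedTree) (S : Node T → Set) : Node T → Node T → Set where
  here : ∀ {s} → S s → WalkIn T S s s
  step : ∀ {s s' u} → S s → TreeAdj T s s' → WalkIn T S s' u → WalkIn T S s u

Connected : (T : RootedTree) → (Node T → Set) → Set
Connected T S = ∀ s u → S s → S u → WalkIn T S s u

data Anc (T : RootedTree) : Node T → Node T → Set where
  anc-refl : ∀ {a} → Anc T a a
  anc-step : ∀ {a i} → Anc T a (parent T i) → Anc T a (suc i)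

DirectedPath : (T : RootedTree) → (Node T → Set) → Set
DirectedPath T S = Σ (Node T) λ a → Σ (Node T) λ d →
  Anc T a d ×
  (∀ s → (S s → Anc T a s × Anc T s d)
       × (Anc T a s × Anc T s d → S s))

record TreeDecomposition (G : Graph) : Set₁ where
  field
    tree  : RootedTree
    bag   : Node tree → List (Vtx G)
    cover : ∀ v → ∃ λ s → v ∈ bag s
    edges : ∀ u v → Edge G u v → ∃ λ s → (u ∈ bag s) × (v ∈ bag s)
    conn  : ∀ v → Connected tree (λ s → v ∈ bag s)

open TreeDecomposition public

WidthAtMost : ∀ {G} → TreeDecomposition G → ℕ → Set
WidthAtMost D k = ∀ s → length (bag D s) ≤ suc k

pathTree : ℕ → RootedTree
pathTree t = record
  { size-1 = t ; parent = inject₁ ; parent-< = λ i → Data.Nat.Properties.≤-reflexive (Data.Fin.Properties.toℕ-inject₁ i) }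
  where import Data.Nat.Properties ; import Data.Fin.Properties

IsPathDecomposition : ∀ {G} → TreeDecomposition G → Set
IsPathDecomposition D = Σ ℕ λ t → tree D ≡ pathTree t

IsOneSided : (φ : CNF) → TreeDecomposition (incidenceGraph φ) → Set
IsOneSided φ D = ∀ (C : Fin (nclauses φ)) → DirectedPath (tree D) (λ s → inj₂ C ∈ bag D s)

-- The width parameters, as "≤ k" predicates
-- (the parameter is the least k for which the predicate holds)

TreewidthAtMost : Graph → ℕ → Set₁
TreewidthAtMost G k = Σ (TreeDecomposition G) λ D → WidthAtMost D k

PrimalTreewidthAtMost : CNF → ℕ → Set₁
PrimalTreewidthAtMost φ k = TreewidthAtMost (primalGraph φ) k

IncidencePathwidthAtMost : CNF → ℕ → Set₁
IncidencePathwidthAtMost φ k =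
  Σ (TreeDecomposition (incidenceGraph φ)) λ D → IsPathDecomposition D × WidthAtMost D k

OneSidedTreewidthAtMost : CNF → ℕ → Set₁
OneSidedTreewidthAtMost φ k =
  Σ (TreeDecomposition (incidenceGraph φ)) λ D → IsOneSided φ D × WidthAtMost D k

-- In a path decomposition the bags containing a clause form an interval, and
-- since the path is rooted at one end an interval is a directed path.  From a
-- primal tree decomposition of width k, hang for every clause C a new leaf
-- holding C and its variables below a bag containing all variables of C.  That
-- bag exists because the variables of C form a clique of the primal graph, and
-- a clique lies in the bag of the deepest among the topmost bags of its
-- vertices.  Each clause then occurs in its leaf only, and every bag has at
-- most k + 2 elements.

module Submission where

open import Defs
open import Data.Nat using (ℕ; suc; _+_; _≤_; s≤s; _≟_)
open import Data.Nat.Properties using (≤-refl; ≤-trans; ≤-antisym; n≤1+n; n≮n; m≤m+n; ≤-pred; ≤∧≢⇒<)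
open import Data.Fin using (Fin; zero; suc; toℕ; inject₁; _↑ˡ_; _↑ʳ_; splitAt)
open import Data.Fin.Properties
  using (toℕ-injective; toℕ-inject₁; toℕ-↑ˡ; toℕ-↑ʳ; toℕ<n; splitAt-↑ˡ; splitAt-↑ʳ; splitAt⁻¹-↑ˡ; splitAt⁻¹-↑ʳ; any?)
  renaming (_≟_ to _≟ᶠ_)
open import Data.Fin.Induction using (<-weakInduction)
open import Data.Product using (∃; _×_; _,_; proj₁; proj₂)
open import Data.Sum using (_⊎_; inj₁; inj₂; [_,_]′)
import Data.Sum.Properties as Sum
open import Data.Bool using (true; false)
import Data.Bool.Properties as Bool
import Data.Product.Properties as Product
open import Data.List using (List; _∷_; map; filter; length; allFin)
open import Data.List.Properties using (length-map; length-filter)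
open import Data.List.Extrema.Nat using (argmin; argmax; argmin-all; argmax-all; f[argmin]≤f[xs]; f[xs]≤f[argmax])
open import Data.List.Membership.Propositional using (_∈_)
open import Data.List.Membership.Propositional.Properties using (∈-map⁺; ∈-map⁻; ∈-filter⁺; ∈-filter⁻; ∈-allFin)
import Data.List.Membership.DecPropositional as DecMembership
open import Data.List.Relation.Unary.Any using (here; there)
open import Data.List.Relation.Unary.All using (lookup)
open import Data.List.Relation.Unary.All.Properties using (all-filter)
open import Data.Empty using (⊥-elim)
open import Function using (_∘_)
open import Relation.Nullary using (yes; no)
open import Relation.Unary using (Decidable)
open import Relation.Binary.Definitions using (DecidableEquality)
open import Relation.Binary.PropositionalEquality using (_≡_; _≢_; refl; sym; trans; cong; subst)
open import Level using (lift)

module _ {n} {P : Fin n → Set} (P? : Decidable P) (f : Fin n → ℕ) where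

  private
    candidates : List (Fin n)
    candidates = filter P? (allFin n)

    candidate : ∀ {y} → P y → y ∈ candidates
    candidate py = ∈-filter⁺ P? (∈-allFin _) py

  minimiser : ∀ {x} → P x → ∃ λ m → P m × (∀ y → P y → f m ≤ f y)
  minimiser {x} px =
    argmin f x candidates ,
    argmin-all f px (all-filter P? (allFin n)) ,
    λ y py → lookup (f[argmin]≤f[xs] {f = f} x candidates) (candidate py)

  maximiser : ∀ {x} → P x → ∃ λ m → P m × (∀ y → P y → f y ≤ f m)
  maximiser {x} px =
    argmax f x candidates ,
    argmax-all f px (all-filter P? (allFin n)) ,
    λ y py → lookup (f[xs]≤f[argmax] {f = f} x candidates) (candidate py)

module _ {T : RootedTree} where

  Anc⇒≤ : ∀ {a s} → Anc T a s → toℕ a ≤ toℕ s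
  Anc⇒≤ anc-refl = ≤-refl
  Anc⇒≤ (anc-step {i = i} a) = ≤-trans (Anc⇒≤ a) (≤-trans (parent-< T i) (n≤1+n _))

  Anc-antisym : ∀ {a b} → Anc T a b → Anc T b a → a ≡ b
  Anc-antisym p q = toℕ-injective (≤-antisym (Anc⇒≤ p) (Anc⇒≤ q))

  Anc-comparable : ∀ {x y s} → Anc T x s → Anc T y s → toℕ x ≤ toℕ y → Anc T x y
  Anc-comparable x≼s anc-refl _ = x≼s
  Anc-comparable anc-refl (anc-step {i = i} y≼s) x≤y =
    ⊥-elim (n≮n _ (≤-trans x≤y (≤-trans (Anc⇒≤ y≼s) (parent-< T i))))
  Anc-comparable (anc-step x≼s) (anc-step y≼s) x≤y = Anc-comparable x≼s y≼s x≤y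

  TreeAdj-sym : ∀ {a b} → TreeAdj T a b → TreeAdj T b a
  TreeAdj-sym (up i) = down i
  TreeAdj-sym (down i) = up i

module _ {T : RootedTree} {S : Node T → Set} where

  walk-source : ∀ {s u} → WalkIn T S s u → S s
  walk-source (here p) = p
  walk-source (step p _ _) = p

  walk-target : ∀ {s u} → WalkIn T S s u → S u
  walk-target (here p) = p
  walk-target (step _ _ w) = walk-target w

  _++ʷ_ : ∀ {a b c} → WalkIn T S a b → WalkIn T S b c → WalkIn T S a c
  here _ ++ʷ w = w
  step p e w₁ ++ʷ w₂ = step p e (w₁ ++ʷ w₂)

  walk-reverse : ∀ {s u} → WalkIn T S s u → WalkIn T S u s
  walk-reverse (here p) = here p
  walk-reverse (step p e w) = walk-reverse w ++ʷ step (walk-source w) (TreeAdj-sym e) (here p)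

  -- A walk can only leave the subtree below m through the parent of m,
  -- whose index is smaller than that of m.
  walk-below-minimum : ∀ {m} → (∀ y → S y → toℕ m ≤ toℕ y) →
                       ∀ {w s} → WalkIn T S w s → Anc T m w → Anc T m s
  walk-below-minimum m-min (here _) m≼w = m≼w
  walk-below-minimum m-min (step _ (up i) w) anc-refl =
    ⊥-elim (n≮n _ (≤-trans (m-min (parent T i) (walk-source w)) (parent-< T i)))
  walk-below-minimum m-min (step _ (up i) w) (anc-step m≼w) = walk-below-minimum m-min w m≼w
  walk-below-minimum m-min (step _ (down i) w) m≼w = walk-below-minimum m-min w (anc-step m≼w)

  walk-from-below : ∀ {b w u} → WalkIn T S w u → Anc T b w → S b ⊎ Anc T b u
  walk-from-below (here _) b≼w = inj₂ b≼w
  walk-from-below (step p (up i) w) anc-refl = inj₁ p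
  walk-from-below (step _ (up i) w) (anc-step b≼w) = walk-from-below w b≼w
  walk-from-below (step _ (down i) w) b≼w = walk-from-below w (anc-step b≼w)

  minimum-Anc : Connected T S → ∀ {m s} → (∀ y → S y → toℕ m ≤ toℕ y) → S m → S s → Anc T m s
  minimum-Anc conn m-min m∈S s∈S = walk-below-minimum m-min (conn _ _ m∈S s∈S) anc-refl

  connected-convex : Connected T S → ∀ {a b s} → S a → S s → Anc T a b → Anc T b s → S b
  connected-convex conn a∈S s∈S a≼b b≼s with walk-from-below (conn _ _ s∈S a∈S) b≼s
  ... | inj₁ b∈S = b∈S
  ... | inj₂ b≼a = subst S (Anc-antisym a≼b b≼a) a∈S

Linear : RootedTree → Set
Linear T = ∀ (x y : Node T) → toℕ x ≤ toℕ y → Anc T x y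

pathTree-linear : ∀ t → Linear (pathTree t)
pathTree-linear t x = <-weakInduction (λ y → toℕ x ≤ toℕ y → Anc (pathTree t) x y) (from-root x) to-successor
  where
  from-root : ∀ x → toℕ x ≤ 0 → Anc (pathTree t) x zero
  from-root zero _ = anc-refl

  to-successor : ∀ i → (toℕ x ≤ toℕ (inject₁ i) → Anc (pathTree t) x (inject₁ i)) →
                 toℕ x ≤ suc (toℕ i) → Anc (pathTree t) x (suc i)
  to-successor i ih x≤1+i with toℕ x ≟ suc (toℕ i)
  ... | yes x≡1+i = subst (λ z → Anc (pathTree t) z (suc i)) (sym (toℕ-injective {j = suc i} x≡1+i)) anc-refl
  ... | no x≢1+i = anc-step (ih (subst (toℕ x ≤_) (sym (toℕ-inject₁ i)) (≤-pred (≤∧≢⇒< x≤1+i x≢1+i))))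

linear-connected⇒DirectedPath : ∀ {T S} → Linear T → Connected T S → Decidable S →
                                ∀ {s} → S s → DirectedPath T S
linear-connected⇒DirectedPath lin conn S? s∈S
  with minimiser S? toℕ s∈S | maximiser S? toℕ s∈S
... | a , a∈S , a-min | d , d∈S , d-max =
  a , d , minimum-Anc conn a-min a∈S d∈S ,
  λ s → (λ s∈S → minimum-Anc conn a-min a∈S s∈S , lin s d (d-max s s∈S))
      , (λ (a≼s , s≼d) → connected-convex conn a∈S d∈S a≼s s≼d)

module _ (φ : CNF) where

  _≟ᵛ_ : DecidableEquality (Fin (nvars φ) ⊎ Fin (nclauses φ))
  _≟ᵛ_ = Sum.≡-dec _≟ᶠ_ _≟ᶠ_

  occurs? : ∀ C → Decidable (λ x → OccursIn φ x C)
  occurs? C x with (true , x) ∈? clause φ C | (false , x) ∈? clause φ C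
    where open DecMembership (Product.≡-dec Bool._≟_ _≟ᶠ_) using (_∈?_)
  ... | yes p | _ = yes (true , p)
  ... | no _ | yes q = yes (false , q)
  ... | no ¬p | no ¬q = no λ { (true , p) → ¬p p ; (false , q) → ¬q q }

pathwidth⇒oneSidedTreewidth : ∀ φ k → IncidencePathwidthAtMost φ k → OneSidedTreewidthAtMost φ k
pathwidth⇒oneSidedTreewidth φ k (D , (t , tree≡path) , width) = D , oneSided , width
  where
  open DecMembership (_≟ᵛ_ φ) using (_∈?_)
  oneSided : IsOneSided φ D
  oneSided C =
    linear-connected⇒DirectedPath (subst Linear (sym tree≡path) (pathTree-linear t))
      (conn D (inj₂ C)) (λ s → inj₂ C ∈? bag D s) (proj₂ (cover D (inj₂ C)))

data Split (a b : ℕ) : Fin (a + b) → Set where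
  left  : ∀ i → Split a b (i ↑ˡ b)
  right : ∀ j → Split a b (a ↑ʳ j)

split : ∀ a b x → Split a b x
split a b x with splitAt a x in eq
... | inj₁ i = subst (Split a b) (splitAt⁻¹-↑ˡ eq) (left i)
... | inj₂ j = subst (Split a b) (splitAt⁻¹-↑ʳ eq) (right j)

GraphOn : (n : ℕ) → (Fin n → Fin n → Set) → Graph
GraphOn n E = record { Vtx = Fin n ; Edge = E }

module _ {n} {E : Fin n → Fin n → Set} (D : TreeDecomposition (GraphOn n E)) where

  private
    open DecMembership (_≟ᶠ_ {n}) using (_∈?_)

    topmost : ∀ v → ∃ λ s → v ∈ bag D s × (∀ y → v ∈ bag D y → toℕ s ≤ toℕ y)
    topmost v = minimiser {P = λ s → v ∈ bag D s} (λ s → v ∈? bag D s) toℕ (proj₂ (cover D v))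

  top : Fin n → Node (tree D)
  top v = proj₁ (topmost v)

  top-∈ : ∀ v → v ∈ bag D (top v)
  top-∈ v = proj₁ (proj₂ (topmost v))

  top-Anc : ∀ {v s} → v ∈ bag D s → Anc (tree D) (top v) s
  top-Anc {v} = minimum-Anc (conn D v) (proj₂ (proj₂ (topmost v))) (top-∈ v)

  -- top u and top v are both ancestors of a bag containing u and v, so
  -- the lower one, top v, lies between top u and that bag.
  adjacent-∈-top : ∀ {u v} → E u v → toℕ (top u) ≤ toℕ (top v) → u ∈ bag D (top v)
  adjacent-∈-top {u} {v} uv top-u≤top-v with edges D u v uv
  ... | s , u∈s , v∈s =
    connected-convex (conn D u) (top-∈ u) u∈s
      (Anc-comparable (top-Anc u∈s) (top-Anc v∈s) top-u≤top-v) (top-Anc v∈s)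

  clique-below-deepest-top : ∀ {Q : Fin n → Set} → (∀ u v → Q u → Q v → u ≢ v → E u v) →
                             ∀ {v} → Q v → (∀ u → Q u → toℕ (top u) ≤ toℕ (top v)) →
                             ∀ u → Q u → u ∈ bag D (top v)
  clique-below-deepest-top clique {v} Qv v-deepest u Qu with u ≟ᶠ v
  ... | yes refl = top-∈ v
  ... | no u≢v = adjacent-∈-top (clique u v Qu Qv u≢v) (v-deepest u Qu)

  clique⊆bag : ∀ {Q : Fin n → Set} → Decidable Q → (∀ u v → Q u → Q v → u ≢ v → E u v) →
               ∃ λ s → ∀ u → Q u → u ∈ bag D s
  clique⊆bag Q? clique with any? Q?
  ... | no ∄Q = zero , λ u Qu → ⊥-elim (∄Q (u , Qu))
  ... | yes (_ , Qv₀) =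
    let v , Qv , v-deepest = maximiser Q? (toℕ ∘ top) Qv₀
    in top v , clique-below-deepest-top clique Qv v-deepest

module AttachLeaves (T : RootedTree) {m} (anchor : Fin m → Node T) where

  private
    t = size-1 T

  parent⁺ : Fin (t + m) → Fin (suc t + m)
  parent⁺ x = [ (λ i → parent T i ↑ˡ m) , (λ j → anchor j ↑ˡ m) ]′ (splitAt t x)

  parent⁺-< : ∀ x → toℕ (parent⁺ x) ≤ toℕ x
  parent⁺-< x with split t m x
  ... | left i rewrite splitAt-↑ˡ t i m | toℕ-↑ˡ (parent T i) m | toℕ-↑ˡ i m = parent-< T i
  ... | right j rewrite splitAt-↑ʳ t m j | toℕ-↑ˡ (anchor j) m | toℕ-↑ʳ t j =
    ≤-trans (≤-pred (toℕ<n (anchor j))) (m≤m+n t (toℕ j))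

  T⁺ : RootedTree
  T⁺ = record { size-1 = t + m ; parent = parent⁺ ; parent-< = parent⁺-< }

  old : Node T → Node T⁺
  old s = s ↑ˡ m

  leaf : Fin m → Node T⁺
  leaf j = suc t ↑ʳ j

  parent⁺-old : ∀ i → parent⁺ (i ↑ˡ m) ≡ old (parent T i)
  parent⁺-old i = cong [ _ , _ ]′ (splitAt-↑ˡ t i m)

  parent⁺-leaf : ∀ j → parent⁺ (t ↑ʳ j) ≡ old (anchor j)
  parent⁺-leaf j = cong [ _ , _ ]′ (splitAt-↑ʳ t m j)

  old-adj : ∀ {a b} → TreeAdj T a b → TreeAdj T⁺ (old a) (old b)
  old-adj (up i) = subst (TreeAdj T⁺ (old (suc i))) (parent⁺-old i) (up (i ↑ˡ m))
  old-adj (down i) = subst (λ z → TreeAdj T⁺ z (old (suc i))) (parent⁺-old i) (down (i ↑ˡ m))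

  leaf-up : ∀ j → TreeAdj T⁺ (leaf j) (old (anchor j))
  leaf-up j = subst (TreeAdj T⁺ (leaf j)) (parent⁺-leaf j) (up (t ↑ʳ j))

  old-walk : ∀ {S : Node T → Set} {S⁺ : Node T⁺ → Set} → (∀ {s} → S s → S⁺ (old s)) →
             ∀ {a b} → WalkIn T S a b → WalkIn T⁺ S⁺ (old a) (old b)
  old-walk S⇒S⁺ (here p) = here (S⇒S⁺ p)
  old-walk S⇒S⁺ (step p e w) = step (S⇒S⁺ p) (old-adj e) (old-walk S⇒S⁺ w)

module PrimalToOneSided (φ : CNF) {k} (D : TreeDecomposition (primalGraph φ)) (width : WidthAtMost D k) where

  private
    t = size-1 (tree D)
    m = nclauses φ
    V = Fin (nvars φ) ⊎ Fin m

    clause-bag : ∀ C → ∃ λ s → ∀ x → OccursIn φ x C → x ∈ bag D s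
    clause-bag C = clique⊆bag D (occurs? φ C) (λ u v u∈C v∈C u≢v → u≢v , C , u∈C , v∈C)

  anchor : Fin m → Node (tree D)
  anchor C = proj₁ (clause-bag C)

  open AttachLeaves (tree D) anchor

  -- The variables of C, taken from the anchor bag so that the leaf bag is no
  -- larger than that bag plus C itself.
  leaf-bag : Fin m → List V
  leaf-bag C = inj₂ C ∷ map inj₁ (filter (occurs? φ C) (bag D (anchor C)))

  bag⁺ : Node T⁺ → List V
  bag⁺ y = [ (λ s → map inj₁ (bag D s)) , leaf-bag ]′ (splitAt (suc t) y)

  bag⁺-old : ∀ s → bag⁺ (old s) ≡ map inj₁ (bag D s)
  bag⁺-old s = cong [ _ , _ ]′ (splitAt-↑ˡ (suc t) s m)

  bag⁺-leaf : ∀ C → bag⁺ (leaf C) ≡ leaf-bag C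
  bag⁺-leaf C = cong [ _ , _ ]′ (splitAt-↑ʳ (suc t) m C)

  VarIn : Fin (nvars φ) → Node T⁺ → Set
  VarIn x y = inj₁ x ∈ bag⁺ y

  ∈-old⁺ : ∀ {x s} → x ∈ bag D s → VarIn x (old s)
  ∈-old⁺ {x} {s} x∈s = subst (inj₁ x ∈_) (sym (bag⁺-old s)) (∈-map⁺ inj₁ x∈s)

  ∈-old⁻ : ∀ {x s} → VarIn x (old s) → x ∈ bag D s
  ∈-old⁻ {x} {s} p with ∈-map⁻ inj₁ (subst (inj₁ x ∈_) (bag⁺-old s) p)
  ... | _ , x∈s , refl = x∈s

  var-∈-leaf : ∀ {x C} → OccursIn φ x C → VarIn x (leaf C)
  var-∈-leaf {x} {C} x∈C = subst (inj₁ x ∈_) (sym (bag⁺-leaf C))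
    (there (∈-map⁺ inj₁ (∈-filter⁺ (occurs? φ C) (proj₂ (clause-bag C) x x∈C) x∈C)))

  clause-∈-leaf : ∀ C → inj₂ C ∈ bag⁺ (leaf C)
  clause-∈-leaf C = subst (inj₂ C ∈_) (sym (bag⁺-leaf C)) (here refl)

  clause-only-at-leaf : ∀ {C y} → inj₂ C ∈ bag⁺ y → y ≡ leaf C
  clause-only-at-leaf {C} {y} p with split (suc t) m y
  ... | left s with ∈-map⁻ inj₁ (subst (inj₂ C ∈_) (bag⁺-old s) p)
  ...   | _ , _ , ()
  clause-only-at-leaf {C} {y} p | right j with subst (inj₂ C ∈_) (bag⁺-leaf j) p
  ...   | here refl = refl
  ...   | there q with ∈-map⁻ inj₁ q
  ...     | _ , _ , ()

  var-reaches-old : ∀ {x} y → VarIn x y → ∃ λ s → x ∈ bag D s × WalkIn T⁺ (VarIn x) y (old s)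
  var-reaches-old {x} y p with split (suc t) m y
  ... | left s = s , ∈-old⁻ p , here p
  ... | right C with subst (inj₁ x ∈_) (bag⁺-leaf C) p
  ...   | there q with ∈-map⁻ inj₁ q
  ...     | _ , x∈filter , refl =
    anchor C , x∈anchor , step p (leaf-up C) (here (∈-old⁺ x∈anchor))
    where
    x∈anchor = proj₁ (∈-filter⁻ (occurs? φ C) x∈filter)

  var-connected : ∀ x → Connected T⁺ (VarIn x)
  var-connected x y z y∋x z∋x with var-reaches-old y y∋x | var-reaches-old z z∋x
  ... | s , x∈s , y→s | r , x∈r , z→r =
    y→s ++ʷ (old-walk ∈-old⁺ (conn D x s r x∈s x∈r) ++ʷ walk-reverse z→r)

  clause-connected : ∀ C → Connected T⁺ (λ y → inj₂ C ∈ bag⁺ y)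
  clause-connected C y z p q =
    subst (WalkIn T⁺ _ y) (trans (clause-only-at-leaf p) (sym (clause-only-at-leaf q))) (here p)

  D⁺ : TreeDecomposition (incidenceGraph φ)
  D⁺ = record
    { tree  = T⁺
    ; bag   = bag⁺
    ; cover = λ { (inj₁ x) → old (proj₁ (cover D x)) , ∈-old⁺ (proj₂ (cover D x))
                ; (inj₂ C) → leaf C , clause-∈-leaf C }
    ; edges = λ { (inj₁ x) (inj₂ C) x∈C → leaf C , var-∈-leaf x∈C , clause-∈-leaf C
                ; (inj₂ C) (inj₁ x) x∈C → leaf C , clause-∈-leaf C , var-∈-leaf x∈C
                ; (inj₁ _) (inj₁ _) (lift ()) ; (inj₂ _) (inj₂ _) (lift ()) }
    ; conn  = λ { (inj₁ x) → var-connected x ; (inj₂ C) → clause-connected C }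
    }

  D⁺-oneSided : IsOneSided φ D⁺
  D⁺-oneSided C = leaf C , leaf C , anc-refl , λ s →
      (λ p → subst (λ z → Anc T⁺ (leaf C) z × Anc T⁺ z (leaf C))
                   (sym (clause-only-at-leaf p)) (anc-refl , anc-refl))
    , (λ (a , b) → subst (λ z → inj₂ C ∈ bag⁺ z) (Anc-antisym a b) (clause-∈-leaf C))

  D⁺-width : WidthAtMost D⁺ (suc k)
  D⁺-width y with split (suc t) m y
  ... | left s rewrite bag⁺-old s | length-map (inj₁ {B = Fin m}) (bag D s) = ≤-trans (width s) (n≤1+n _)
  ... | right C rewrite bag⁺-leaf C | length-map (inj₁ {B = Fin m}) (filter (occurs? φ C) (bag D (anchor C))) =
    s≤s (≤-trans (length-filter (occurs? φ C) (bag D (anchor C))) (width (anchor C)))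

primalTreewidth⇒oneSidedTreewidth : ∀ φ k → PrimalTreewidthAtMost φ k → OneSidedTreewidthAtMost φ (suc k)
primalTreewidth⇒oneSidedTreewidth φ k (D , width) = D⁺ , D⁺-oneSided , D⁺-width
  where open PrimalToOneSided φ D width

proposition2 : (φ : CNF) →
    ((k : ℕ) → IncidencePathwidthAtMost φ k → OneSidedTreewidthAtMost φ k) ×
    ((k : ℕ) → PrimalTreewidthAtMost φ k → OneSidedTreewidthAtMost φ (suc k))
proposition2 φ = pathwidth⇒oneSidedTreewidth φ , primalTreewidth⇒oneSidedTreewidth φ
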